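{- Let $G=(V,E)$ be a locally finite, connected, simple, unweighted $C_4$-free graph equipped with the non-normalized Laplacian $\Delta f(x)=\sum_{y\sim x}(f(y)-f(x))$. If $G$ satisfies $CD(0,\infty)$ and contains at least one triangle, then $G\cong C_3$ or $G\cong C_3'$.
   Context: $G$ is $C_4$-free if it contains no $4$-cycle as a subgraph. For $f,g:V\to\mathbb R$ define $2\Gamma(f,g)=\Delta(fg)-f\Delta g-g\Delta f$ and $2\Gamma_2(f,g)=\Delta\Gamma(f,g)-\Gamma(f,\Delta g)-\Gamma(\Delta f,g)$, $\Gamma_2(f)=\Gamma_2(f,f)$. $G$ satisfies $CD(0,\infty)$ if $\Gamma_2(f)(x)\ge0$ for all $f:V\to\mathbb R$ and all $x\in V$. $C_3'$ is the graph obtained from a triangle by attaching one pendant vertex (of degree $1$) to one vertex of the triangle. -}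

module Defs where

open import Level using (0ℓ)
open import Data.Fin using (Fin; zero; suc)
open import Data.List using (List; foldr; map)
open import Data.List.Membership.Propositional using (_∈_)
open import Data.List.Relation.Unary.Unique.Propositional using (Unique)
open import Data.Product using (Σ; _×_; ∃-syntax)
open import Data.Rational using (ℚ; 0ℚ; ½; _+_; _*_; _-_; _≤_)
open import Function.Bundles using (_↔_; _⇔_; Inverse)
open import Relation.Binary.PropositionalEquality using (_≡_)
open import Relation.Nullary using (¬_)

-- A simple, locally finite, undirected graph: each vertex has a finite
-- list of neighbours (without repetitions), no loops, symmetric adjacency.
record Graph : Set₁ where
  field
    V          : Set
    nbrs       : V → List V
    nbrs-uniq  : ∀ x → Unique (nbrs x)
    loopless   : ∀ x → ¬ (x ∈ nbrs x)
    symmetric  : ∀ x y → y ∈ nbrs x → x ∈ nbrs y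

  Adj : V → V → Set
  Adj x y = y ∈ nbrs x

module _ (G : Graph) where
  open Graph G

  data Reach : V → V → Set where
    here : ∀ {x} → Reach x x
    step : ∀ {x y z} → Adj x y → Reach y z → Reach x z

  Connected : Set
  Connected = ∀ x y → Reach x y

  C4Free : Set
  C4Free = ¬ (∃[ a ] ∃[ b ] ∃[ c ] ∃[ d ]
              (¬ a ≡ b × ¬ a ≡ c × ¬ a ≡ d × ¬ b ≡ c × ¬ b ≡ d × ¬ c ≡ d) ×
              Adj a b × Adj b c × Adj c d × Adj d a)

  HasTriangle : Set
  HasTriangle = ∃[ a ] ∃[ b ] ∃[ c ] (Adj a b × Adj b c × Adj c a)

  sumℚ : List ℚ → ℚ
  sumℚ = foldr _+_ 0ℚ

  Δ : (V → ℚ) → V → ℚ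
  Δ f x = sumℚ (map (λ y → f y - f x) (nbrs x))

  Γ : (V → ℚ) → (V → ℚ) → V → ℚ
  Γ f g x = ½ * (Δ (λ y → f y * g y) x - f x * Δ g x - g x * Δ f x)

  Γ₂ : (V → ℚ) → (V → ℚ) → V → ℚ
  Γ₂ f g x = ½ * (Δ (Γ f g) x - Γ f (Δ g) x - Γ (Δ f) g x)

  CD0∞ : Set
  CD0∞ = ∀ (f : V → ℚ) (x : V) → 0ℚ ≤ Γ₂ f f x

_≅_ : (G : Graph) {n : _} → (Fin n → Fin n → Set) → Set
_≅_ G {n} H = Σ (Graph.V G ↔ Fin n) λ φ →
  ∀ x y → Graph.Adj G x y ⇔ H (Inverse.to φ x) (Inverse.to φ y)

C3Adj : Fin 3 → Fin 3 → Set
C3Adj i j = ¬ i ≡ j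

-- C₃' : triangle 0,1,2 with pendant vertex 3 attached to 0
data C3'Adj : Fin 4 → Fin 4 → Set where
  e01 : C3'Adj zero (suc zero)
  e10 : C3'Adj (suc zero) zero
  e12 : C3'Adj (suc zero) (suc (suc zero))
  e21 : C3'Adj (suc (suc zero)) (suc zero)
  e20 : C3'Adj (suc (suc zero)) zero
  e02 : C3'Adj zero (suc (suc zero))
  e03 : C3'Adj zero (suc (suc (suc zero)))
  e30 : C3'Adj (suc (suc (suc zero))) zero

-- In a C4-free graph two distinct vertices have at most one common neighbour. Let x lie on a
-- triangle x y₁ y₂ and have degree D ≥ 3. Then y₁ y₂ is the only edge of N(x) at y₁ or y₂, and
-- every vertex at distance 2 from x has a unique neighbour y in N(x). This makes the test
-- function f well defined: f(x) = 0, f = D − 2 on y₁ and y₂, f = −2 on the other neighbours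
-- of x, and f(w) = 2 f(y) at distance 2. Since f(x) = Δf(x) = 0, expanding Γ₂ gives
-- 4 Γ₂(f)(x) ≤ (3 − D) Σ_{y∼x} f(y)², losing another f(y)² ≥ 1 if some y ∼ x has a neighbour at
-- distance 2. So CD(0,∞) forces D = 3 and N(x) ∪ {x} closed under adjacency. By connectedness,
-- a triangle whose vertices have no further neighbours is all of G = C₃, and a triangle vertex
-- with a third neighbour p gives G = C₃′, since C4-freeness forbids edges from p to the triangle.

module Submission where

open import Defs
open import Data.Empty using (⊥; ⊥-elim)
open import Data.Fin using (Fin; zero; suc; toℕ) renaming (_<_ to _<ᶠ_)
import Data.Fin.Properties as Fin
open import Data.List using (List; []; _∷_; foldr; map; length; head; drop)
import Data.List as List
open import Data.List.Membership.Propositional using (_∈_; _∉_; find; lose)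
open import Data.List.Properties using (≡-dec)
open import Data.List.Relation.Unary.Any using (here; there; index; any?)
open import Data.List.Relation.Unary.Any.Properties using (lookup-index)
open import Data.List.Relation.Unary.All using (all?) renaming (lookup to All-lookup)
open import Data.List.Relation.Unary.All.Properties using (¬All⇒Any¬)
open import Data.List.Relation.Unary.AllPairs using (_∷_)
open import Data.List.Relation.Unary.Unique.Propositional using (Unique)
open import Data.Maybe using (Maybe; just; _>>=_)
open import Data.Maybe.Properties using (just-injective)
open import Data.Nat using (ℕ; zero; suc; _≤?_) renaming (_≤_ to _≤ℕ_; _+_ to _+ℕ_)
import Data.Nat.Properties as ℕ
open import Data.Product using (∃-syntax; _×_; _,_; proj₁; proj₂)
open import Data.Rational using (ℚ; 0ℚ; 1ℚ; ½; _+_; _*_; _-_; -_; _≤_; nonNegative; nonPositive)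
open import Data.Rational.Properties
  using (+-*-commutativeRing; ≤-refl; ≤-trans; ≤-reflexive; ≤-total; +-mono-≤; +-monoˡ-≤; +-monoʳ-≤;
         nonNegative⁻¹; *-cancelˡ-≤-pos; *-monoˡ-≤-nonNeg; *-monoʳ-≤-nonNeg; *-monoʳ-≤-nonPos)
import Data.Rational.Properties as ℚ
open import Data.Sum using (_⊎_; inj₁; inj₂)
open import Data.Vec using (Vec; []; _∷_)
import Data.Vec as Vec
open import Data.Vec.Relation.Unary.All using (All; []; _∷_)
open import Data.Vec.Relation.Unary.All.Properties using (lookup⁺)
open import Data.Vec.Relation.Unary.AllPairs using ([]; _∷_)
import Data.Vec.Relation.Unary.Unique.Propositional as Vecᵁ
open import Data.Vec.Relation.Unary.Unique.Propositional.Properties using (lookup-injective)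
open import Function using (_∘_)
open import Function.Bundles using (mk↔ₛ′; mk⇔)
open import Level using (0ℓ)
open import Relation.Binary.Definitions using (DecidableEquality)
open import Relation.Binary.PropositionalEquality
open import Relation.Nullary using (¬_; yes; no; Dec)
open import Relation.Nullary.Decidable using (dec⇒maybe; _⊎-dec_; from-yes; from-no)
open import Tactic.RingSolver using (solve-∀)
open import Tactic.RingSolver.Core.AlmostCommutativeRing
  using (AlmostCommutativeRing; fromCommutativeRing)

ℚ-ring : AlmostCommutativeRing 0ℓ 0ℓ
ℚ-ring = fromCommutativeRing +-*-commutativeRing (λ p → dec⇒maybe (0ℚ ℚ.≟ p))

module _ {A : Set} where

  ∑ : List A → (A → ℚ) → ℚ
  ∑ L g = foldr _+_ 0ℚ (map g L)

  ∑-cong : ∀ L {g h : A → ℚ} → (∀ {y} → y ∈ L → g y ≡ h y) → ∑ L g ≡ ∑ L h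
  ∑-cong []      eq = refl
  ∑-cong (a ∷ L) eq = cong₂ _+_ (eq (here refl)) (∑-cong L (eq ∘ there))

  ∑-+ : ∀ L (g h : A → ℚ) → ∑ L (λ y → g y + h y) ≡ ∑ L g + ∑ L h
  ∑-+ []      g h = refl
  ∑-+ (a ∷ L) g h = trans (cong (g a + h a +_) (∑-+ L g h)) (lemma (g a) (h a) (∑ L g) (∑ L h))
    where lemma : ∀ p q r s → p + q + (r + s) ≡ p + r + (q + s)
          lemma = solve-∀ ℚ-ring

  ∑-sub : ∀ L (g h : A → ℚ) → ∑ L (λ y → g y - h y) ≡ ∑ L g - ∑ L h
  ∑-sub []      g h = refl
  ∑-sub (a ∷ L) g h = trans (cong (g a - h a +_) (∑-sub L g h)) (lemma (g a) (h a) (∑ L g) (∑ L h))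
    where lemma : ∀ p q r s → p - q + (r - s) ≡ p + r - (q + s)
          lemma = solve-∀ ℚ-ring

  *-distribˡ-∑ : ∀ L c (g : A → ℚ) → c * ∑ L g ≡ ∑ L (λ y → c * g y)
  *-distribˡ-∑ []      c g = ℚ.*-zeroʳ c
  *-distribˡ-∑ (a ∷ L) c g =
    trans (ℚ.*-distribˡ-+ c (g a) (∑ L g)) (cong (c * g a +_) (*-distribˡ-∑ L c g))

  ∑-nonneg : ∀ L {g : A → ℚ} → (∀ {y} → y ∈ L → 0ℚ ≤ g y) → 0ℚ ≤ ∑ L g
  ∑-nonneg []      nonneg = ≤-refl
  ∑-nonneg (a ∷ L) nonneg = +-mono-≤ (nonneg (here refl)) (∑-nonneg L (nonneg ∘ there))

  ∑-mono-≤ : ∀ L {g h : A → ℚ} → (∀ {y} → y ∈ L → g y ≤ h y) → ∑ L g ≤ ∑ L h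
  ∑-mono-≤ []      g≤h = ≤-refl
  ∑-mono-≤ (a ∷ L) g≤h = +-mono-≤ (g≤h (here refl)) (∑-mono-≤ L (g≤h ∘ there))

  ∑-mono-≤-at : ∀ L {g h : A → ℚ} {a} ε → (∀ {y} → y ∈ L → g y ≤ h y) →
                a ∈ L → g a + ε ≤ h a → ∑ L g + ε ≤ ∑ L h
  ∑-mono-≤-at (b ∷ L) {g} {h} ε g≤h (here refl) gap = begin
    g b + ∑ L g + ε   ≡⟨ lemma (g b) (∑ L g) ε ⟩
    g b + ε + ∑ L g   ≤⟨ +-mono-≤ gap (∑-mono-≤ L (g≤h ∘ there)) ⟩
    h b + ∑ L h       ∎
    where open ℚ.≤-Reasoning
          lemma : ∀ p q r → p + q + r ≡ p + r + q
          lemma = solve-∀ ℚ-ring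
  ∑-mono-≤-at (b ∷ L) {g} {h} ε g≤h (there a∈L) gap = begin
    g b + ∑ L g + ε    ≡⟨ ℚ.+-assoc (g b) (∑ L g) ε ⟩
    g b + (∑ L g + ε)  ≤⟨ +-mono-≤ (g≤h (here refl)) (∑-mono-≤-at L ε (g≤h ∘ there) a∈L gap) ⟩
    h b + ∑ L h        ∎
    where open ℚ.≤-Reasoning

  ∑-≥-member : ∀ L {g : A → ℚ} {a} → (∀ {y} → y ∈ L → 0ℚ ≤ g y) → a ∈ L → g a ≤ ∑ L g
  ∑-≥-member L {g} {a} nonneg a∈L = begin
    g a                   ≡⟨ ℚ.+-identityˡ (g a) ⟨
    0ℚ + g a              ≤⟨ +-monoˡ-≤ (g a) (∑-nonneg L {λ _ → 0ℚ} (λ _ → ≤-refl)) ⟩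
    ∑ L (λ _ → 0ℚ) + g a  ≤⟨ ∑-mono-≤-at L (g a) nonneg a∈L (≤-reflexive (ℚ.+-identityˡ (g a))) ⟩
    ∑ L g                 ∎
    where open ℚ.≤-Reasoning

  module _ (_≟_ : DecidableEquality A) where

    δ : A → A → ℚ
    δ a y with y ≟ a
    ... | yes _ = 1ℚ
    ... | no  _ = 0ℚ

    δ-refl : ∀ a → δ a a ≡ 1ℚ
    δ-refl a with a ≟ a
    ... | yes _   = refl
    ... | no  a≢a = ⊥-elim (a≢a refl)

    δ-≢ : ∀ {a y} → ¬ y ≡ a → δ a y ≡ 0ℚ
    δ-≢ {a} {y} y≢a with y ≟ a
    ... | yes y≡a = ⊥-elim (y≢a y≡a)
    ... | no  _   = refl

    ∑-δ-∉ : ∀ L {a} → a ∉ L → ∑ L (δ a) ≡ 0ℚ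
    ∑-δ-∉ []      a∉L = refl
    ∑-δ-∉ (b ∷ L) a∉L = cong₂ _+_ (δ-≢ (λ b≡a → a∉L (here (sym b≡a)))) (∑-δ-∉ L (a∉L ∘ there))

    ∑-δ : ∀ L {a} → Unique L → a ∈ L → ∑ L (δ a) ≡ 1ℚ
    ∑-δ (b ∷ L) (b∉L ∷ _) (here refl) =
      cong₂ _+_ (δ-refl b) (∑-δ-∉ L (λ b∈L → All-lookup b∉L b∈L refl))
    ∑-δ (b ∷ L) {a} (b∉L ∷ uniq) (there a∈L) =
      cong₂ _+_ (δ-≢ (All-lookup b∉L a∈L)) (∑-δ L uniq a∈L)

1≤1+p : ∀ {p} → 0ℚ ≤ p → 1ℚ ≤ 1ℚ + p
1≤1+p 0≤p = ≤-trans (≤-reflexive (sym (ℚ.+-identityʳ 1ℚ))) (+-monoʳ-≤ 1ℚ 0≤p)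

fromℕ : ℕ → ℚ
fromℕ zero    = 0ℚ
fromℕ (suc n) = 1ℚ + fromℕ n

fromℕ-nonneg : ∀ n → 0ℚ ≤ fromℕ n
fromℕ-nonneg zero    = ≤-refl
fromℕ-nonneg (suc n) = +-mono-≤ (nonNegative⁻¹ 1ℚ) (fromℕ-nonneg n)

fromℕ-≥1 : ∀ {n} → 1 ≤ℕ n → 1ℚ ≤ fromℕ n
fromℕ-≥1 {suc n} _ = 1≤1+p (fromℕ-nonneg n)

∑-1≡length : ∀ {A : Set} (L : List A) → ∑ L (λ _ → 1ℚ) ≡ fromℕ (length L)
∑-1≡length []      = refl
∑-1≡length (a ∷ L) = cong (1ℚ +_) (∑-1≡length L)

0≤p*p : ∀ p → 0ℚ ≤ p * p
0≤p*p p = ≤-trans (≤-reflexive (sym (ℚ.*-zeroˡ p))) 0*p≤p*p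
  where
    0*p≤p*p : 0ℚ * p ≤ p * p
    0*p≤p*p with ≤-total 0ℚ p
    ... | inj₁ 0≤p = *-monoʳ-≤-nonNeg p {{nonNegative 0≤p}} 0≤p
    ... | inj₂ p≤0 = *-monoʳ-≤-nonPos p {{nonPositive p≤0}} p≤0

1≤p*q : ∀ {p q} → 1ℚ ≤ p → 1ℚ ≤ q → 1ℚ ≤ p * q
1≤p*q {p} {q} 1≤p 1≤q = begin
  1ℚ      ≡⟨ ℚ.*-identityˡ 1ℚ ⟨
  1ℚ * 1ℚ ≤⟨ *-monoʳ-≤-nonNeg 1ℚ 1≤p ⟩
  p * 1ℚ  ≤⟨ *-monoˡ-≤-nonNeg p {{nonNegative (≤-trans (nonNegative⁻¹ 1ℚ) 1≤p)}} 1≤q ⟩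
  p * q   ∎
  where open ℚ.≤-Reasoning

1≰0 : ¬ (1ℚ ≤ 0ℚ)
1≰0 = from-no (1ℚ ℚ.≤? 0ℚ)

module _ {A : Set} where

  distinct-members-≤-length : ∀ {n} {P : Vec A n} {L : List A} →
                              Vecᵁ.Unique P → All (_∈ L) P → n ≤ℕ length L
  distinct-members-≤-length {n} {P} {L} distinct P⊆L with n ≤? length L
  ... | yes n≤ = n≤
  ... | no  n≰ = ⊥-elim (collision (Fin.pigeonhole (ℕ.≰⇒> n≰) position))
    where
      position : Fin n → Fin (length L)
      position i = index (lookup⁺ P⊆L i)

      collision : (∃[ i ] ∃[ j ] (i <ᶠ j × position i ≡ position j)) → ⊥
      collision (i , j , i<j , same) = Fin.<⇒≢ i<j (lookup-injective distinct i j (begin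
        Vec.lookup P i                  ≡⟨ lookup-index (lookup⁺ P⊆L i) ⟩
        List.lookup L (position i)      ≡⟨ cong (List.lookup L) same ⟩
        List.lookup L (position j)      ≡⟨ lookup-index (lookup⁺ P⊆L j) ⟨
        Vec.lookup P j                  ∎))
        where open ≡-Reasoning

module _ (G : Graph) where
  open Graph G

  Adj-sym : ∀ {a b} → Adj a b → Adj b a
  Adj-sym = symmetric _ _

  Adj⇒≢ : ∀ {a b} → Adj a b → ¬ a ≡ b
  Adj⇒≢ {a} ab refl = loopless a ab

  private
    code : ∀ {x y} → Reach G x y → List ℕ
    code here       = []
    code (step p r) = toℕ (index p) ∷ code r

    decode : V → List ℕ → Maybe V
    decode x []       = just x
    decode x (i ∷ is) = head (drop i (nbrs x)) >>= λ y → decode y is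

    head-drop-index : ∀ {y} {L : List V} (p : y ∈ L) → head (drop (toℕ (index p)) L) ≡ just y
    head-drop-index (here refl) = refl
    head-drop-index (there p)   = head-drop-index p

    decode-code : ∀ {x y} (r : Reach G x y) → decode x (code r) ≡ just y
    decode-code here                                = refl
    decode-code (step p r) rewrite head-drop-index p = decode-code r

  -- A vertex is determined by the code of the walk to it that connectedness provides.
  Connected⇒DecidableEquality : Connected G → V → DecidableEquality V
  Connected⇒DecidableEquality conn o v w with ≡-dec ℕ._≟_ (code (conn o v)) (code (conn o w))
  ... | yes same = yes (just-injective (begin
    just v                    ≡⟨ decode-code (conn o v) ⟨
    decode o (code (conn o v)) ≡⟨ cong (decode o) same ⟩
    decode o (code (conn o w)) ≡⟨ decode-code (conn o w) ⟩
    just w                    ∎))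
    where open ≡-Reasoning
  ... | no differ = no (differ ∘ cong (code ∘ conn o))

  module _ (_≟_ : DecidableEquality V) (c4 : C4Free G) where

    common-neighbour-unique : ∀ {a b c d} → ¬ a ≡ b →
                              Adj a c → Adj c b → Adj a d → Adj d b → c ≡ d
    common-neighbour-unique {c = c} {d} a≢b ac cb ad db with c ≟ d
    ... | yes c≡d = c≡d
    ... | no  c≢d = ⊥-elim (c4 (_ , _ , _ , _ ,
          (Adj⇒≢ ac , a≢b , Adj⇒≢ ad , Adj⇒≢ cb , c≢d , Adj⇒≢ db ∘ sym) ,
          ac , cb , Adj-sym db , Adj-sym ad))

  Γ-∑ : ∀ f g x → Γ G f g x ≡ ½ * ∑ (nbrs x) (λ y → (f y - f x) * (g y - g x))
  Γ-∑ f g x = cong (½ *_) (begin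
    ∑ N fg - f x * ∑ N dg - g x * ∑ N df
      ≡⟨ cong₂ (λ s t → ∑ N fg - s - t) (*-distribˡ-∑ N (f x) dg) (*-distribˡ-∑ N (g x) df) ⟩
    ∑ N fg - ∑ N (λ y → f x * dg y) - ∑ N (λ y → g x * df y)
      ≡⟨ trans (∑-sub N (λ y → fg y - f x * dg y) (λ y → g x * df y))
               (cong (_- ∑ N (λ y → g x * df y)) (∑-sub N fg (λ y → f x * dg y))) ⟨
    ∑ N (λ y → fg y - f x * dg y - g x * df y)
      ≡⟨ ∑-cong N (λ {y} _ → lemma (f y) (g y) (f x) (g x)) ⟩
    ∑ N (λ y → (f y - f x) * (g y - g x)) ∎)
    where
      open ≡-Reasoning
      N : List V
      N = nbrs x
      fg df dg : V → ℚ
      fg y = f y * g y - f x * g x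
      df y = f y - f x
      dg y = g y - g x
      lemma : ∀ a b a₀ b₀ → a * b - a₀ * b₀ - a₀ * (b - b₀) - b₀ * (a - a₀) ≡ (a - a₀) * (b - b₀)
      lemma = solve-∀ ℚ-ring

  Γ₂-∑ : ∀ f x → Γ₂ G f f x ≡
         ½ * ∑ (nbrs x) (λ y → Γ G f f y - Γ G f f x - (f y - f x) * (Δ G f y - Δ G f x))
  Γ₂-∑ f x = cong (½ *_) (begin
    ∑ N a - Γ G f (Δ G f) x - Γ G (Δ G f) f x
      ≡⟨ cong₂ (λ s t → ∑ N a - s - t) (Γ-∑ f (Δ G f) x) (Γ-∑ (Δ G f) f x) ⟩
    ∑ N a - ½ * ∑ N b - ½ * ∑ N b′
      ≡⟨ cong₂ (λ s t → ∑ N a - s - t) (*-distribˡ-∑ N ½ b) (*-distribˡ-∑ N ½ b′) ⟩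
    ∑ N a - ∑ N (λ y → ½ * b y) - ∑ N (λ y → ½ * b′ y)
      ≡⟨ trans (∑-sub N (λ y → a y - ½ * b y) (λ y → ½ * b′ y))
               (cong (_- ∑ N (λ y → ½ * b′ y)) (∑-sub N a (λ y → ½ * b y))) ⟨
    ∑ N (λ y → a y - ½ * b y - ½ * b′ y)
      ≡⟨ ∑-cong N (λ {y} _ → lemma (a y) (f y - f x) (Δ G f y - Δ G f x)) ⟩
    ∑ N (λ y → a y - b y) ∎)
    where
      open ≡-Reasoning
      N : List V
      N = nbrs x
      a b b′ : V → ℚ
      a y  = Γ G f f y - Γ G f f x
      b y  = (f y - f x) * (Δ G f y - Δ G f x)
      b′ y = (Δ G f y - Δ G f x) * (f y - f x)
      lemma : ∀ p s t → p - ½ * (s * t) - ½ * (t * s) ≡ p - s * t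
      lemma = solve-∀ ℚ-ring

  τ : (V → ℚ) → V → V → ℚ
  τ f y w = ½ * ((f w - f y) * (f w - f y)) - f y * (f w - f y)

  ∑-τ : ∀ f y → ∑ (nbrs y) (τ f y) ≡ Γ G f f y - f y * Δ G f y
  ∑-τ f y = begin
    ∑ N (τ f y)
      ≡⟨ ∑-sub N (λ w → ½ * ((f w - f y) * (f w - f y))) (λ w → f y * (f w - f y)) ⟩
    ∑ N (λ w → ½ * ((f w - f y) * (f w - f y))) - ∑ N (λ w → f y * (f w - f y))
      ≡⟨ cong₂ _-_ (*-distribˡ-∑ N ½ _) (*-distribˡ-∑ N (f y) _) ⟨
    ½ * ∑ N (λ w → (f w - f y) * (f w - f y)) - f y * Δ G f y
      ≡⟨ cong (_- f y * Δ G f y) (Γ-∑ f f y) ⟨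
    Γ G f f y - f y * Δ G f y ∎
    where
      open ≡-Reasoning
      N : List V
      N = nbrs y

  Γ₂-∑-τ : ∀ f x → f x ≡ 0ℚ → Δ G f x ≡ 0ℚ →
           Γ₂ G f f x ≡ ½ * ∑ (nbrs x) (λ y → ∑ (nbrs y) (τ f y) - Γ G f f x)
  Γ₂-∑-τ f x fx≡0 Δfx≡0 = trans (Γ₂-∑ f x) (cong (½ *_) (∑-cong (nbrs x) summand))
    where
      summand : ∀ {y} → y ∈ nbrs x →
                Γ G f f y - Γ G f f x - (f y - f x) * (Δ G f y - Δ G f x) ≡
                ∑ (nbrs y) (τ f y) - Γ G f f x
      summand {y} _ = begin
        Γ G f f y - Γ G f f x - (f y - f x) * (Δ G f y - Δ G f x)
          ≡⟨ cong₂ (λ s t → Γ G f f y - Γ G f f x - (f y - s) * (Δ G f y - t)) fx≡0 Δfx≡0 ⟩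
        Γ G f f y - Γ G f f x - (f y - 0ℚ) * (Δ G f y - 0ℚ)
          ≡⟨ lemma (Γ G f f y) (Γ G f f x) (f y) (Δ G f y) ⟩
        Γ G f f y - f y * Δ G f y - Γ G f f x
          ≡⟨ cong (_- Γ G f f x) (∑-τ f y) ⟨
        ∑ (nbrs y) (τ f y) - Γ G f f x ∎
        where
          open ≡-Reasoning
          lemma : ∀ p q s t → p - q - (s - 0ℚ) * (t - 0ℚ) ≡ p - s * t - q
          lemma = solve-∀ ℚ-ring

2ℚ : ℚ
2ℚ = 1ℚ + 1ℚ

module TestFunction
  (G : Graph) (_≟_ : DecidableEquality (Graph.V G)) (c4 : C4Free G) (cd : CD0∞ G)
  {x y₁ y₂ : Graph.V G} (xy₁ : Graph.Adj G x y₁) (xy₂ : Graph.Adj G x y₂) (y₁y₂ : Graph.Adj G y₁ y₂)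
  (deg≥3 : 3 ≤ℕ length (Graph.nbrs G x))
  where

  open Graph G
  open import Data.List.Membership.DecPropositional _≟_ using (_∈?_)

  N : List V
  N = nbrs x

  D : ℚ
  D = ∑ N (λ _ → 1ℚ)

  excess : ℕ
  excess = proj₁ (ℕ.m≤n⇒∃[o]m+o≡n deg≥3)

  3+excess≡deg : 3 +ℕ excess ≡ length N
  3+excess≡deg = proj₂ (ℕ.m≤n⇒∃[o]m+o≡n deg≥3)

  e : ℚ
  e = fromℕ excess

  e-nonneg : 0ℚ ≤ e
  e-nonneg = fromℕ-nonneg excess

  D≡3+e : D ≡ 1ℚ + (1ℚ + (1ℚ + e))
  D≡3+e = trans (∑-1≡length N) (cong fromℕ (sym 3+excess≡deg))

  InPair : V → Set
  InPair v = v ≡ y₁ ⊎ v ≡ y₂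

  InPair? : ∀ v → Dec (InPair v)
  InPair? v = (v ≟ y₁) ⊎-dec (v ≟ y₂)

  ι : V → ℚ
  ι v = δ _≟_ y₁ v + δ _≟_ y₂ v

  ι-pair : ∀ {v} → InPair v → ι v ≡ 1ℚ
  ι-pair (inj₁ refl) = trans (cong₂ _+_ (δ-refl _≟_ y₁) (δ-≢ _≟_ (Adj⇒≢ G y₁y₂))) (ℚ.+-identityʳ 1ℚ)
  ι-pair (inj₂ refl) = trans (cong₂ _+_ (δ-≢ _≟_ (Adj⇒≢ G y₁y₂ ∘ sym)) (δ-refl _≟_ y₂)) (ℚ.+-identityˡ 1ℚ)

  ι-unpaired : ∀ {v} → ¬ InPair v → ι v ≡ 0ℚ
  ι-unpaired ¬pair = cong₂ _+_ (δ-≢ _≟_ (¬pair ∘ inj₁)) (δ-≢ _≟_ (¬pair ∘ inj₂))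

  pair-closed : ∀ {y w} → Adj x y → Adj y w → Adj x w → InPair y → InPair w
  pair-closed _ yw xw (inj₁ refl) =
    inj₂ (common-neighbour-unique G _≟_ c4 (Adj⇒≢ G xy₁) xw (Adj-sym G yw) xy₂ (Adj-sym G y₁y₂))
  pair-closed _ yw xw (inj₂ refl) =
    inj₁ (common-neighbour-unique G _≟_ c4 (Adj⇒≢ G xy₂) xw (Adj-sym G yw) xy₁ y₁y₂)

  ι-edge : ∀ {y w} → Adj x y → Adj x w → Adj y w → ι w ≡ ι y
  ι-edge {y} xy xw yw with InPair? y
  ... | yes pair = trans (ι-pair (pair-closed xy yw xw pair)) (sym (ι-pair pair))
  ... | no ¬pair =
    trans (ι-unpaired (¬pair ∘ pair-closed xw (Adj-sym G yw) xy)) (sym (ι-unpaired ¬pair))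

  parent-unique : ∀ {y y′ w} → Adj x y → Adj x y′ → Adj y w → Adj y′ w → ¬ w ≡ x → y′ ≡ y
  parent-unique xy xy′ yw y′w w≢x = common-neighbour-unique G _≟_ c4 (w≢x ∘ sym) xy′ y′w xy yw

  u : V → ℚ
  u v = D * ι v - 2ℚ

  u-pair : ∀ {v} → InPair v → u v ≡ 1ℚ + e
  u-pair {v} pair = begin
    D * ι v - 2ℚ                         ≡⟨ cong₂ (λ d i → d * i - 2ℚ) D≡3+e (ι-pair pair) ⟩
    (1ℚ + (1ℚ + (1ℚ + e))) * 1ℚ - 2ℚ     ≡⟨ lemma e ⟩
    1ℚ + e                               ∎
    where
      open ≡-Reasoning
      lemma : ∀ e → (1ℚ + (1ℚ + (1ℚ + e))) * 1ℚ - 2ℚ ≡ 1ℚ + e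
      lemma = solve-∀ ℚ-ring

  u-unpaired : ∀ {v} → ¬ InPair v → u v ≡ - 2ℚ
  u-unpaired {v} ¬pair = begin
    D * ι v - 2ℚ   ≡⟨ cong (λ i → D * i - 2ℚ) (ι-unpaired ¬pair) ⟩
    D * 0ℚ - 2ℚ    ≡⟨ lemma D ⟩
    - 2ℚ           ∎
    where
      open ≡-Reasoning
      lemma : ∀ d → d * 0ℚ - 2ℚ ≡ - 2ℚ
      lemma = solve-∀ ℚ-ring

  -- Vertices at distance ≥ 3 from x do not enter Γ₂ f (x); they get the junk value 0.
  f : V → ℚ
  f v with v ≟ x
  ... | yes _ = 0ℚ
  ... | no  _ with v ∈? N
  ...   | yes _ = u v
  ...   | no  _ with any? (λ y → v ∈? nbrs y) N
  ...     | yes parent = 2ℚ * u (proj₁ (find parent))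
  ...     | no  _      = 0ℚ

  f-x : f x ≡ 0ℚ
  f-x with x ≟ x
  ... | yes _   = refl
  ... | no  x≢x = ⊥-elim (x≢x refl)

  f-N : ∀ {y} → Adj x y → f y ≡ u y
  f-N {y} xy with y ≟ x
  ... | yes refl = ⊥-elim (loopless x xy)
  ... | no  _ with y ∈? N
  ...   | yes _  = refl
  ...   | no  y∉N = ⊥-elim (y∉N xy)

  f-parent : ∀ {y w} → Adj x y → Adj y w → ¬ w ≡ x → w ∉ N → f w ≡ 2ℚ * f y
  f-parent {y} {w} xy yw w≢x w∉N rewrite f-N xy with w ≟ x
  ... | yes w≡x = ⊥-elim (w≢x w≡x)
  ... | no  _ with w ∈? N
  ...   | yes w∈N = ⊥-elim (w∉N w∈N)
  ...   | no  _ with any? (λ y → w ∈? nbrs y) N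
  ...     | yes parent = let (_ , xy′ , y′w) = find parent in
                          cong (λ z → 2ℚ * u z) (parent-unique xy xy′ yw y′w w≢x)
  ...     | no  orphan = ⊥-elim (orphan (lose xy yw))

  f-edge : ∀ {y w} → Adj x y → Adj x w → Adj y w → f w ≡ f y
  f-edge {y} {w} xy xw yw = begin
    f w    ≡⟨ f-N xw ⟩
    u w    ≡⟨ cong (λ i → D * i - 2ℚ) (ι-edge xy xw yw) ⟩
    u y    ≡⟨ f-N xy ⟨
    f y    ∎
    where open ≡-Reasoning

  Δf-x : Δ G f x ≡ 0ℚ
  Δf-x = begin
    ∑ N (λ y → f y - f x)
      ≡⟨ ∑-cong N (λ xy → cong₂ _-_ (f-N xy) f-x) ⟩
    ∑ N (λ y → D * ι y - 2ℚ - 0ℚ)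
      ≡⟨ ∑-cong N (λ {y} _ → lemma D (ι y)) ⟩
    ∑ N (λ y → D * ι y - 2ℚ * 1ℚ)
      ≡⟨ ∑-sub N (λ y → D * ι y) (λ _ → 2ℚ * 1ℚ) ⟩
    ∑ N (λ y → D * ι y) - ∑ N (λ _ → 2ℚ * 1ℚ)
      ≡⟨ cong₂ _-_ (*-distribˡ-∑ N D ι) (*-distribˡ-∑ N 2ℚ (λ _ → 1ℚ)) ⟨
    D * ∑ N ι - 2ℚ * D
      ≡⟨ cong (λ s → D * s - 2ℚ * D) ∑ι≡2 ⟩
    D * (1ℚ + 1ℚ) - 2ℚ * D
      ≡⟨ lemma′ D ⟩
    0ℚ ∎
    where
      open ≡-Reasoning
      ∑ι≡2 : ∑ N ι ≡ 1ℚ + 1ℚ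
      ∑ι≡2 = trans (∑-+ N (δ _≟_ y₁) (δ _≟_ y₂))
                   (cong₂ _+_ (∑-δ _≟_ N (nbrs-uniq x) xy₁) (∑-δ _≟_ N (nbrs-uniq x) xy₂))
      lemma : ∀ d i → d * i - 2ℚ - 0ℚ ≡ d * i - 2ℚ * 1ℚ
      lemma = solve-∀ ℚ-ring
      lemma′ : ∀ d → d * (1ℚ + 1ℚ) - 2ℚ * d ≡ 0ℚ
      lemma′ = solve-∀ ℚ-ring

  Q : ℚ
  Q = ∑ N (λ y → f y * f y)

  Γf-x : Γ G f f x ≡ ½ * Q
  Γf-x = trans (Γ-∑ G f f x) (cong (½ *_) (∑-cong N λ {y} _ → begin
    (f y - f x) * (f y - f x) ≡⟨ cong (λ t → (f y - t) * (f y - t)) f-x ⟩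
    (f y - 0ℚ) * (f y - 0ℚ)   ≡⟨ cong (λ s → s * s) (ℚ.+-identityʳ (f y)) ⟩
    f y * f y                 ∎))
    where open ≡-Reasoning

  T : V → ℚ
  T y = ∑ (nbrs y) (τ G f y)

  bound : V → ℚ
  bound y = (1ℚ + ½) * (f y * f y)

  τ-x : ∀ y → τ G f y x ≡ bound y
  τ-x y rewrite f-x = lemma (f y)
    where lemma : ∀ s → ½ * ((0ℚ - s) * (0ℚ - s)) - s * (0ℚ - s) ≡ (1ℚ + ½) * (s * s)
          lemma = solve-∀ ℚ-ring

  τ-edge : ∀ {y w} → Adj x y → Adj x w → Adj y w → τ G f y w ≡ 0ℚ
  τ-edge {y} xy xw yw rewrite f-edge xy xw yw = lemma (f y)
    where lemma : ∀ s → ½ * ((s - s) * (s - s)) - s * (s - s) ≡ 0ℚ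
          lemma = solve-∀ ℚ-ring

  τ-parent : ∀ {y w} → Adj x y → Adj y w → ¬ w ≡ x → w ∉ N →
             τ G f y w + ½ * (f y * f y) ≡ 0ℚ
  τ-parent {y} xy yw w≢x w∉N rewrite f-parent xy yw w≢x w∉N = lemma (f y)
    where lemma : ∀ s → ½ * ((2ℚ * s - s) * (2ℚ * s - s)) - s * (2ℚ * s - s) + ½ * (s * s) ≡ 0ℚ
          lemma = solve-∀ ℚ-ring

  bound-δ-≢ : ∀ {y w} → ¬ w ≡ x → bound y * δ _≟_ x w ≡ 0ℚ
  bound-δ-≢ {y} w≢x = trans (cong (bound y *_) (δ-≢ _≟_ w≢x)) (ℚ.*-zeroʳ (bound y))

  τ-bound-parent : ∀ {y w} → Adj x y → Adj y w → ¬ w ≡ x → w ∉ N →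
                   τ G f y w + ½ * (f y * f y) ≤ bound y * δ _≟_ x w
  τ-bound-parent xy yw w≢x w∉N =
    ≤-reflexive (trans (τ-parent xy yw w≢x w∉N) (sym (bound-δ-≢ w≢x)))

  τ-bound : ∀ {y w} → Adj x y → Adj y w → τ G f y w ≤ bound y * δ _≟_ x w
  τ-bound {y} {w} xy yw = by-position (w ≟ x) (w ∈? N)
    where
      open ℚ.≤-Reasoning
      by-position : Dec (w ≡ x) → Dec (w ∈ N) → τ G f y w ≤ bound y * δ _≟_ x w
      by-position (yes refl) _ = ≤-reflexive (trans (τ-x y)
        (sym (trans (cong (bound y *_) (δ-refl _≟_ x)) (ℚ.*-identityʳ (bound y)))))
      by-position (no w≢x) (yes xw) =
        ≤-reflexive (trans (τ-edge xy xw yw) (sym (bound-δ-≢ w≢x)))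
      by-position (no w≢x) (no w∉N) = begin
        τ G f y w                   ≡⟨ ℚ.+-identityʳ (τ G f y w) ⟨
        τ G f y w + 0ℚ              ≤⟨ +-monoʳ-≤ (τ G f y w) (*-monoˡ-≤-nonNeg ½ (0≤p*p (f y))) ⟩
        τ G f y w + ½ * (f y * f y) ≤⟨ τ-bound-parent xy yw w≢x w∉N ⟩
        bound y * δ _≟_ x w         ∎

  ∑-bound-δ : ∀ {y} → Adj x y → ∑ (nbrs y) (λ w → bound y * δ _≟_ x w) ≡ bound y
  ∑-bound-δ {y} xy = begin
    ∑ (nbrs y) (λ w → bound y * δ _≟_ x w)
      ≡⟨ *-distribˡ-∑ (nbrs y) (bound y) (δ _≟_ x) ⟨
    bound y * ∑ (nbrs y) (δ _≟_ x)
      ≡⟨ cong (bound y *_) (∑-δ _≟_ (nbrs y) (nbrs-uniq y) (Adj-sym G xy)) ⟩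
    bound y * 1ℚ
      ≡⟨ ℚ.*-identityʳ (bound y) ⟩
    bound y ∎
    where open ≡-Reasoning

  T-bound : ∀ {y} → Adj x y → T y ≤ bound y
  T-bound {y} xy = ≤-trans (∑-mono-≤ (nbrs y) (τ-bound xy)) (≤-reflexive (∑-bound-δ xy))

  T-bound-parent : ∀ {y w} → Adj x y → Adj y w → ¬ w ≡ x → w ∉ N →
                   T y + ½ * (f y * f y) ≤ bound y
  T-bound-parent {y} xy yw w≢x w∉N = ≤-trans
    (∑-mono-≤-at (nbrs y) (½ * (f y * f y)) (τ-bound xy) yw (τ-bound-parent xy yw w≢x w∉N))
    (≤-reflexive (∑-bound-δ xy))

  Γ₂f-x : Γ₂ G f f x ≡ ½ * ∑ N (λ y → T y - ½ * Q)
  Γ₂f-x = trans (Γ₂-∑-τ G f x f-x Δf-x) (cong (λ g → ½ * ∑ N (λ y → T y - g)) Γf-x)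

  ∑-T-nonneg : 0ℚ ≤ ∑ N (λ y → T y - ½ * Q)
  ∑-T-nonneg = *-cancelˡ-≤-pos ½ (begin
    ½ * 0ℚ                       ≡⟨ ℚ.*-zeroʳ ½ ⟩
    0ℚ                           ≤⟨ cd f x ⟩
    Γ₂ G f f x                   ≡⟨ Γ₂f-x ⟩
    ½ * ∑ N (λ y → T y - ½ * Q)  ∎)
    where open ℚ.≤-Reasoning

  ∑-bound : ∑ N (λ y → bound y - ½ * Q) ≡ - (½ * (e * Q))
  ∑-bound = begin
    ∑ N (λ y → bound y - ½ * Q)
      ≡⟨ ∑-sub N bound (λ _ → ½ * Q) ⟩
    ∑ N bound - ∑ N (λ _ → ½ * Q)
      ≡⟨ cong₂ _-_ (*-distribˡ-∑ N (1ℚ + ½) (λ y → f y * f y)) ∑-const ⟨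
    (1ℚ + ½) * Q - ½ * Q * D
      ≡⟨ cong (λ d → (1ℚ + ½) * Q - ½ * Q * d) D≡3+e ⟩
    (1ℚ + ½) * Q - ½ * Q * (1ℚ + (1ℚ + (1ℚ + e)))
      ≡⟨ lemma Q e ⟩
    - (½ * (e * Q)) ∎
    where
      open ≡-Reasoning
      ∑-const : ½ * Q * D ≡ ∑ N (λ _ → ½ * Q)
      ∑-const = trans (*-distribˡ-∑ N (½ * Q) (λ _ → 1ℚ)) (∑-cong N (λ _ → ℚ.*-identityʳ (½ * Q)))
      lemma : ∀ q e → (1ℚ + ½) * q - ½ * q * (1ℚ + (1ℚ + (1ℚ + e))) ≡ - (½ * (e * q))
      lemma = solve-∀ ℚ-ring

  -- Summing T-bound over N gives 4 Γ₂ f (x) ≤ (3 − deg x) Q − 2 ε, and deg x = 3 + e.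
  CD⇒e*Q+ε≤0 : ∀ {y₀} ε → Adj x y₀ → T y₀ + ½ * ε ≤ bound y₀ → e * Q + ε ≤ 0ℚ
  CD⇒e*Q+ε≤0 {y₀} ε xy₀ gap = *-cancelˡ-≤-pos ½ (begin
    ½ * (e * Q + ε)
      ≡⟨ ℚ.*-distribˡ-+ ½ (e * Q) ε ⟩
    ½ * (e * Q) + ½ * ε
      ≡⟨ cong (½ * (e * Q) +_) (ℚ.+-identityˡ (½ * ε)) ⟨
    ½ * (e * Q) + (0ℚ + ½ * ε)
      ≤⟨ +-monoʳ-≤ (½ * (e * Q)) (+-monoˡ-≤ (½ * ε) ∑-T-nonneg) ⟩
    ½ * (e * Q) + (∑ N (λ y → T y - ½ * Q) + ½ * ε)
      ≤⟨ +-monoʳ-≤ (½ * (e * Q)) summed ⟩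
    ½ * (e * Q) + ∑ N (λ y → bound y - ½ * Q)
      ≡⟨ cong (½ * (e * Q) +_) ∑-bound ⟩
    ½ * (e * Q) - ½ * (e * Q)
      ≡⟨ ℚ.+-inverseʳ (½ * (e * Q)) ⟩
    0ℚ
      ≡⟨ ℚ.*-zeroʳ ½ ⟨
    ½ * 0ℚ ∎)
    where
      open ℚ.≤-Reasoning
      lemma : ∀ p q r → p - q + r ≡ p + r - q
      lemma = solve-∀ ℚ-ring
      summed : ∑ N (λ y → T y - ½ * Q) + ½ * ε ≤ ∑ N (λ y → bound y - ½ * Q)
      summed = ∑-mono-≤-at N (½ * ε) (λ xy → +-monoˡ-≤ (- (½ * Q)) (T-bound xy)) xy₀
        (≤-trans (≤-reflexive (lemma (T y₀) (½ * Q) (½ * ε))) (+-monoˡ-≤ (- (½ * Q)) gap))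

  f²≥1 : ∀ {y} → Adj x y → 1ℚ ≤ f y * f y
  f²≥1 {y} xy with InPair? y
  ... | yes pair  = subst (λ s → 1ℚ ≤ s * s) (sym (trans (f-N xy) (u-pair pair)))
                          (1≤p*q (1≤1+p e-nonneg) (1≤1+p e-nonneg))
  ... | no  ¬pair = subst (λ s → 1ℚ ≤ s * s) (sym (trans (f-N xy) (u-unpaired ¬pair)))
                          (from-yes (1ℚ ℚ.≤? - 2ℚ * - 2ℚ))

  Q≥1 : 1ℚ ≤ Q
  Q≥1 = ≤-trans (f²≥1 xy₁) (∑-≥-member N (λ {y} _ → 0≤p*p (f y)) xy₁)

  no-fourth-neighbour : ¬ (4 ≤ℕ length N)
  no-fourth-neighbour 4≤deg = 1≰0 (begin
    1ℚ          ≤⟨ 1≤p*q (fromℕ-≥1 1≤excess) Q≥1 ⟩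
    e * Q       ≡⟨ ℚ.+-identityʳ (e * Q) ⟨
    e * Q + 0ℚ  ≤⟨ CD⇒e*Q+ε≤0 0ℚ xy₁ T+0≤bound ⟩
    0ℚ          ∎)
    where
      open ℚ.≤-Reasoning
      1≤excess : 1 ≤ℕ excess
      1≤excess = ℕ.+-cancelˡ-≤ 3 1 excess (subst (4 ≤ℕ_) (sym 3+excess≡deg) 4≤deg)
      T+0≤bound : T y₁ + ½ * 0ℚ ≤ bound y₁
      T+0≤bound = ≤-trans
        (≤-reflexive (trans (cong (T y₁ +_) (ℚ.*-zeroʳ ½)) (ℚ.+-identityʳ (T y₁))))
        (T-bound xy₁)

  neighbourhood-closed : ∀ {y w} → Adj x y → Adj y w → w ≡ x ⊎ Adj x w
  neighbourhood-closed {y} {w} xy yw with w ≟ x | w ∈? N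
  ... | yes w≡x | _        = inj₁ w≡x
  ... | no  _   | yes xw   = inj₂ xw
  ... | no  w≢x | no  w∉N  = ⊥-elim (1≰0 (begin
    1ℚ                   ≡⟨ ℚ.+-identityˡ 1ℚ ⟨
    0ℚ + 1ℚ              ≤⟨ +-mono-≤ 0≤eQ (f²≥1 xy) ⟩
    e * Q + f y * f y    ≤⟨ CD⇒e*Q+ε≤0 (f y * f y) xy (T-bound-parent xy yw w≢x w∉N) ⟩
    0ℚ                   ∎))
    where
      open ℚ.≤-Reasoning
      0≤eQ : 0ℚ ≤ e * Q
      0≤eQ = ≤-trans (≤-reflexive (sym (ℚ.*-zeroˡ Q)))
                     (*-monoʳ-≤-nonNeg Q {{nonNegative (≤-trans (nonNegative⁻¹ 1ℚ) Q≥1)}} e-nonneg)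

module _ (G : Graph) (_≟_ : DecidableEquality (Graph.V G)) (c4 : C4Free G) (cd : CD0∞ G) where
  open Graph G

  third-neighbour-structure :
    ∀ {x y₁ y₂ p} → Adj x y₁ → Adj x y₂ → Adj y₁ y₂ → Adj x p → ¬ p ≡ y₁ → ¬ p ≡ y₂ →
    (∀ {w} → Adj x w → w ≡ y₁ ⊎ w ≡ y₂ ⊎ w ≡ p) ×
    (∀ {y w} → Adj x y → Adj y w → w ≡ x ⊎ Adj x w)
  third-neighbour-structure {x} {y₁} {y₂} {p} xy₁ xy₂ y₁y₂ xp p≢y₁ p≢y₂ =
    neighbours , TF.neighbourhood-closed
    where
      y₁≢y₂ : ¬ y₁ ≡ y₂
      y₁≢y₂ = Adj⇒≢ G y₁y₂

      module TF = TestFunction G _≟_ c4 cd xy₁ xy₂ y₁y₂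
        (distinct-members-≤-length ((y₁≢y₂ ∷ p≢y₁ ∘ sym ∷ []) ∷ (p≢y₂ ∘ sym ∷ []) ∷ [] ∷ [])
                                   (xy₁ ∷ xy₂ ∷ xp ∷ []))

      neighbours : ∀ {w} → Adj x w → w ≡ y₁ ⊎ w ≡ y₂ ⊎ w ≡ p
      neighbours {w} xw with w ≟ y₁ | w ≟ y₂ | w ≟ p
      ... | yes w≡y₁ | _        | _      = inj₁ w≡y₁
      ... | no  _    | yes w≡y₂ | _      = inj₂ (inj₁ w≡y₂)
      ... | no  _    | no  _    | yes w≡p = inj₂ (inj₂ w≡p)
      ... | no w≢y₁  | no w≢y₂  | no w≢p = ⊥-elim (TF.no-fourth-neighbour
        (distinct-members-≤-length
          ((w≢y₁ ∷ w≢y₂ ∷ w≢p ∷ []) ∷ (y₁≢y₂ ∷ p≢y₁ ∘ sym ∷ []) ∷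
           (p≢y₂ ∘ sym ∷ []) ∷ [] ∷ [])
          (xw ∷ xy₁ ∷ xy₂ ∷ xp ∷ [])))

module _ (G : Graph) (conn : Connected G) where
  open Graph G

  enumeration⇒≅ : ∀ {n} (vs : Vec V (suc n)) → Vecᵁ.Unique vs →
                  (H : Fin (suc n) → Fin (suc n) → Set) →
                  (∀ i j → H i j → Adj (Vec.lookup vs i) (Vec.lookup vs j)) →
                  (∀ i {w} → Adj (Vec.lookup vs i) w → ∃[ j ] (H i j × w ≡ Vec.lookup vs j)) →
                  G ≅ H
  enumeration⇒≅ {n} vs distinct H edge neighbours =
    mk↔ₛ′ position (Vec.lookup vs) position-lookup lookup-position ,
    λ v w → mk⇔ (forward v w) (backward v w)
    where
      listed : ∀ {v w} → Reach G v w → ∃[ i ] v ≡ Vec.lookup vs i → ∃[ j ] w ≡ Vec.lookup vs j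
      listed here        v-listed   = v-listed
      listed (step vu r) (i , refl) with neighbours i vu
      ... | j , _ , u≡j = listed r (j , u≡j)

      enumerated : ∀ v → ∃[ i ] v ≡ Vec.lookup vs i
      enumerated v = listed (conn (Vec.lookup vs zero) v) (zero , refl)

      position : V → Fin (suc n)
      position v = proj₁ (enumerated v)

      lookup-position : ∀ v → Vec.lookup vs (position v) ≡ v
      lookup-position v = sym (proj₂ (enumerated v))

      position-lookup : ∀ i → position (Vec.lookup vs i) ≡ i
      position-lookup i = lookup-injective distinct _ _ (lookup-position (Vec.lookup vs i))

      forward : ∀ v w → Adj v w → H (position v) (position w)
      forward v w vw with neighbours (position v) (subst (λ u → Adj u w) (sym (lookup-position v)) vw)
      ... | j , hj , w≡j =
        subst (H (position v)) (sym (lookup-injective distinct _ _ (trans (lookup-position w) w≡j))) hj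

      backward : ∀ v w → H (position v) (position w) → Adj v w
      backward v w h = subst₂ Adj (lookup-position v) (lookup-position w) (edge _ _ h)

module _ (G : Graph) (conn : Connected G) (_≟_ : DecidableEquality (Graph.V G))
         (c4 : C4Free G) (cd : CD0∞ G) where
  open Graph G

  third-neighbour? : ∀ a b c →
                     (∀ {w} → Adj a w → w ≡ b ⊎ w ≡ c) ⊎ ∃[ p ] (Adj a p × ¬ p ≡ b × ¬ p ≡ c)
  third-neighbour? a b c with all? (λ w → (w ≟ b) ⊎-dec (w ≟ c)) (nbrs a)
  ... | yes inside = inj₁ (All-lookup inside)
  ... | no  ¬inside with find (¬All⇒Any¬ (λ w → (w ≟ b) ⊎-dec (w ≟ c)) (nbrs a) ¬inside)
  ...   | p , ap , p∉ = inj₂ (p , ap , p∉ ∘ inj₁ , p∉ ∘ inj₂)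

  triangle≅C3 : ∀ {a b c} → Adj a b → Adj b c → Adj c a →
                (∀ {w} → Adj a w → w ≡ b ⊎ w ≡ c) → (∀ {w} → Adj b w → w ≡ c ⊎ w ≡ a) →
                (∀ {w} → Adj c w → w ≡ a ⊎ w ≡ b) → G ≅ C3Adj
  triangle≅C3 {a} {b} {c} ab bc ca na nb nc = enumeration⇒≅ G conn vs
    ((Adj⇒≢ G ab ∷ Adj⇒≢ G ca ∘ sym ∷ []) ∷ (Adj⇒≢ G bc ∷ []) ∷ [] ∷ []) C3Adj edge neighbours
    where
      vs : Vec V 3
      vs = a ∷ b ∷ c ∷ []

      edge : ∀ i j → C3Adj i j → Adj (Vec.lookup vs i) (Vec.lookup vs j)
      edge zero             zero             i≢j = ⊥-elim (i≢j refl)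
      edge zero             (suc zero)       _   = ab
      edge zero             (suc (suc zero)) _   = Adj-sym G ca
      edge (suc zero)       zero             _   = Adj-sym G ab
      edge (suc zero)       (suc zero)       i≢j = ⊥-elim (i≢j refl)
      edge (suc zero)       (suc (suc zero)) _   = bc
      edge (suc (suc zero)) zero             _   = ca
      edge (suc (suc zero)) (suc zero)       _   = Adj-sym G bc
      edge (suc (suc zero)) (suc (suc zero)) i≢j = ⊥-elim (i≢j refl)

      neighbours : ∀ i {w} → Adj (Vec.lookup vs i) w → ∃[ j ] (C3Adj i j × w ≡ Vec.lookup vs j)
      neighbours zero aw with na aw
      ... | inj₁ w≡b = suc zero , (λ ()) , w≡b
      ... | inj₂ w≡c = suc (suc zero) , (λ ()) , w≡c
      neighbours (suc zero) bw with nb bw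
      ... | inj₁ w≡c = suc (suc zero) , (λ ()) , w≡c
      ... | inj₂ w≡a = zero , (λ ()) , w≡a
      neighbours (suc (suc zero)) cw with nc cw
      ... | inj₁ w≡a = zero , (λ ()) , w≡a
      ... | inj₂ w≡b = suc zero , (λ ()) , w≡b

  module TriangleWithPendant {a b c p} (ab : Adj a b) (bc : Adj b c) (ca : Adj c a) (ap : Adj a p)
                             (p≢b : ¬ p ≡ b) (p≢c : ¬ p ≡ c) where

    ac : Adj a c
    ac = Adj-sym G ca

    na : ∀ {w} → Adj a w → w ≡ b ⊎ w ≡ c ⊎ w ≡ p
    na = proj₁ (third-neighbour-structure G _≟_ c4 cd ab ac bc ap p≢b p≢c)

    closed : ∀ {y w} → Adj a y → Adj y w → w ≡ a ⊎ Adj a w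
    closed = proj₂ (third-neighbour-structure G _≟_ c4 cd ab ac bc ap p≢b p≢c)

    ¬bp : ¬ Adj b p
    ¬bp bp =
      p≢c (sym (common-neighbour-unique G _≟_ c4 (Adj⇒≢ G ab) ac (Adj-sym G bc) ap (Adj-sym G bp)))

    ¬cp : ¬ Adj c p
    ¬cp cp = p≢b (sym (common-neighbour-unique G _≟_ c4 (Adj⇒≢ G ac) ab bc ap (Adj-sym G cp)))

    nb : ∀ {w} → Adj b w → w ≡ a ⊎ w ≡ c
    nb bw with closed ab bw
    ... | inj₁ w≡a = inj₁ w≡a
    ... | inj₂ aw with na aw
    ...   | inj₁ refl        = ⊥-elim (loopless b bw)
    ...   | inj₂ (inj₁ w≡c)  = inj₂ w≡c
    ...   | inj₂ (inj₂ refl) = ⊥-elim (¬bp bw)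

    nc : ∀ {w} → Adj c w → w ≡ a ⊎ w ≡ b
    nc cw with closed ac cw
    ... | inj₁ w≡a = inj₁ w≡a
    ... | inj₂ aw with na aw
    ...   | inj₁ w≡b         = inj₂ w≡b
    ...   | inj₂ (inj₁ refl) = ⊥-elim (loopless c cw)
    ...   | inj₂ (inj₂ refl) = ⊥-elim (¬cp cw)

    np : ∀ {w} → Adj p w → w ≡ a
    np pw with closed ap pw
    ... | inj₁ w≡a = w≡a
    ... | inj₂ aw with na aw
    ...   | inj₁ refl        = ⊥-elim (¬bp (Adj-sym G pw))
    ...   | inj₂ (inj₁ refl) = ⊥-elim (¬cp (Adj-sym G pw))
    ...   | inj₂ (inj₂ refl) = ⊥-elim (loopless p pw)

    vs : Vec V 4
    vs = a ∷ b ∷ c ∷ p ∷ []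

    edge : ∀ i j → C3'Adj i j → Adj (Vec.lookup vs i) (Vec.lookup vs j)
    edge _ _ e01 = ab
    edge _ _ e10 = Adj-sym G ab
    edge _ _ e12 = bc
    edge _ _ e21 = Adj-sym G bc
    edge _ _ e20 = ca
    edge _ _ e02 = ac
    edge _ _ e03 = ap
    edge _ _ e30 = Adj-sym G ap

    neighbours : ∀ i {w} → Adj (Vec.lookup vs i) w → ∃[ j ] (C3'Adj i j × w ≡ Vec.lookup vs j)
    neighbours zero aw with na aw
    ... | inj₁ w≡b        = suc zero , e01 , w≡b
    ... | inj₂ (inj₁ w≡c) = suc (suc zero) , e02 , w≡c
    ... | inj₂ (inj₂ w≡p) = suc (suc (suc zero)) , e03 , w≡p
    neighbours (suc zero) bw with nb bw
    ... | inj₁ w≡a = zero , e10 , w≡a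
    ... | inj₂ w≡c = suc (suc zero) , e12 , w≡c
    neighbours (suc (suc zero)) cw with nc cw
    ... | inj₁ w≡a = zero , e20 , w≡a
    ... | inj₂ w≡b = suc zero , e21 , w≡b
    neighbours (suc (suc (suc zero))) pw = zero , e30 , np pw

    ≅C3′ : G ≅ C3'Adj
    ≅C3′ = enumeration⇒≅ G conn vs
      ((Adj⇒≢ G ab ∷ Adj⇒≢ G ac ∷ Adj⇒≢ G ap ∷ []) ∷ (Adj⇒≢ G bc ∷ p≢b ∘ sym ∷ []) ∷
       (p≢c ∘ sym ∷ []) ∷ [] ∷ [])
      C3'Adj edge neighbours

  triangle-classification : ∀ {a b c} → Adj a b → Adj b c → Adj c a → (G ≅ C3Adj) ⊎ (G ≅ C3'Adj)
  triangle-classification {a} {b} {c} ab bc ca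
    with third-neighbour? a b c | third-neighbour? b c a | third-neighbour? c a b
  ... | inj₂ (p , ap , p≢b , p≢c) | _ | _ = inj₂ (TriangleWithPendant.≅C3′ ab bc ca ap p≢b p≢c)
  ... | inj₁ _ | inj₂ (p , bp , p≢c , p≢a) | _ = inj₂ (TriangleWithPendant.≅C3′ bc ca ab bp p≢c p≢a)
  ... | inj₁ _ | inj₁ _ | inj₂ (p , cp , p≢a , p≢b) = inj₂ (TriangleWithPendant.≅C3′ ca ab bc cp p≢a p≢b)
  ... | inj₁ na | inj₁ nb | inj₁ nc = inj₁ (triangle≅C3 ab bc ca na nb nc)

theorem3p1 : (G : Graph) → Connected G → C4Free G → CD0∞ G → HasTriangle G →
    (G ≅ C3Adj) ⊎ (G ≅ C3'Adj)
theorem3p1 G conn c4 cd (a , b , c , ab , bc , ca) =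
  triangle-classification G conn (Connected⇒DecidableEquality G conn a) c4 cd ab bc ca
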